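{- For all types $A,B$ with $A\equiv B$, we have $PF(A)\sim PF(B)$.
   Context: Types: $A ::= X \mid A\Rightarrow A \mid A\wedge A \mid \forall X.A$, $X$ type variables, modulo $\alpha$-equivalence; $\Rightarrow$ associates to the right. Type isomorphism $\equiv$ is the smallest congruence on types containing: $A\wedge B\equiv B\wedge A$; $A\wedge(B\wedge C)\equiv(A\wedge B)\wedge C$; $A\Rightarrow(B\wedge C)\equiv(A\Rightarrow B)\wedge(A\Rightarrow C)$; $(A\wedge B)\Rightarrow C\equiv A\Rightarrow B\Rightarrow C$; $\forall X.(A\Rightarrow B)\equiv A\Rightarrow\forall X.B$ if $X\notin FTV(A)$; $\forall X.(A\wedge B)\equiv\forall X.A\wedge\forall X.B$. Write $\forall\vec X.A$ for $\forall X_1\dots\forall X_n.A$ ($n\ge 0$). Prime factors $PF(A)$ (a multiset of types of the form $\forall\vec X.(B\Rightarrow Y)$, $Y$ a type variable, a factor $\forall\vec X.Y$ being regarded as the case with empty antecedent): $PF(X)=[X]$; $PF(A\Rightarrow B)=[\forall\vec X_i.((A\wedge B_i)\Rightarrow Y_i)]_{i=1}^n$ where $PF(B)=[\forall\vec X_i.(B_i\Rightarrow Y_i)]_{i=1}^n$ (with $A\wedge B_i$ read as $A$ when $B_i$ is empty, bound variables renamed to avoid capture); $PF(A\wedge B)=PF(A)\uplus PF(B)$; $PF(\forall X.A)=[\forall X.\forall\vec Y_i.(A_i\Rightarrow Z_i)]_{i=1}^n$ where $PF(A)=[\forall\vec Y_i.(A_i\Rightarrow Z_i)]_{i=1}^n$.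 For multisets, $[A_1,\dots,A_n]\sim[B_1,\dots,B_m]$ means $n=m$ and there is a permutation $p$ of $\{1,\dots,n\}$ with $A_i\equiv B_{p(i)}$ for all $i$. -}

module Defs where

open import Data.Nat using (ℕ; zero; suc; _<ᵇ_)
open import Data.Bool using (if_then_else_)
open import Data.Maybe using (Maybe; just; nothing; maybe)
open import Data.List using (List; []; _∷_; _++_; map; length; lookup)
open import Data.Fin using (Fin)
open import Data.Fin.Permutation using (Permutation; _⟨$⟩ʳ_)
open import Data.Product using (Σ; _×_; _,_)

-- Types in de Bruijn form: α-equivalent types are syntactically equal.
-- var n : the type variable with de Bruijn index n (bound if n < number of
-- enclosing ∀', free otherwise).
infixr 6 _⇒_
infixr 7 _∧_
data Ty : Set where
  var : ℕ → Ty
  _⇒_ : Ty → Ty → Ty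
  _∧_ : Ty → Ty → Ty
  ∀' : Ty → Ty

shiftFrom : ℕ → Ty → Ty
shiftFrom c (var x) = if x <ᵇ c then var x else var (suc x)
shiftFrom c (A ⇒ B) = shiftFrom c A ⇒ shiftFrom c B
shiftFrom c (A ∧ B) = shiftFrom c A ∧ shiftFrom c B
shiftFrom c (∀' A) = ∀' (shiftFrom (suc c) A)

wk : Ty → Ty
wk = shiftFrom 0

wkN : ℕ → Ty → Ty
wkN zero A = A
wkN (suc k) A = wk (wkN k A)

∀N : ℕ → Ty → Ty
∀N zero A = A
∀N (suc k) A = ∀' (∀N k A)

-- Type isomorphism: smallest congruence containing the six axioms.
-- The ∀/⇒ axiom  ∀X.(A ⇒ B) ≡ A ⇒ ∀X.B  (X ∉ FTV(A)) reads in de Bruijn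
-- form  ∀'(wk A ⇒ B) ≅ A ⇒ ∀' B.
infix 4 _≅_
data _≅_ : Ty → Ty → Set where
  ≅-refl  : ∀ {A} → A ≅ A
  ≅-sym   : ∀ {A B} → A ≅ B → B ≅ A
  ≅-trans : ∀ {A B C} → A ≅ B → B ≅ C → A ≅ C
  cong-⇒  : ∀ {A A' B B'} → A ≅ A' → B ≅ B' → (A ⇒ B) ≅ (A' ⇒ B')
  cong-∧  : ∀ {A A' B B'} → A ≅ A' → B ≅ B' → (A ∧ B) ≅ (A' ∧ B')
  cong-∀  : ∀ {A A'} → A ≅ A' → ∀' A ≅ ∀' A'
  comm    : ∀ {A B} → (A ∧ B) ≅ (B ∧ A)
  asso    : ∀ {A B C} → (A ∧ (B ∧ C)) ≅ ((A ∧ B) ∧ C)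
  dist    : ∀ {A B C} → (A ⇒ (B ∧ C)) ≅ ((A ⇒ B) ∧ (A ⇒ C))
  curry   : ∀ {A B C} → ((A ∧ B) ⇒ C) ≅ (A ⇒ B ⇒ C)
  p-dist  : ∀ {A B} → ∀' (wk A ⇒ B) ≅ (A ⇒ ∀' B)
  gen     : ∀ {A B} → ∀' (A ∧ B) ≅ (∀' A ∧ ∀' B)

-- A prime factor ∀X1..Xk.(B ⇒ Y) : k binders, optional antecedent B
-- (nothing = empty antecedent, i.e. the factor ∀X1..Xk.Y), target variable Y
-- (de Bruijn index relative to the k binders).
record Factor : Set where
  constructor factor
  field
    binders : ℕ
    ante    : Maybe Ty
    target  : ℕ

factorTy : Factor → Ty
factorTy (factor k nothing y)  = ∀N k (var y)
factorTy (factor k (just B) y) = ∀N k (B ⇒ var y)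

PF : Ty → List Factor
PF (var x) = factor 0 nothing x ∷ []
PF (A ⇒ B) = map step (PF B)
  where
  step : Factor → Factor
  step (factor k mb y) = factor k (just (maybe (λ Bi → wkN k A ∧ Bi) (wkN k A) mb)) y
PF (A ∧ B) = PF A ++ PF B
PF (∀' A) = map (λ { (factor k mb y) → factor (suc k) mb y }) (PF A)

-- Multiset equivalence up to ≅ : a bijection p (forcing equal lengths)
-- with A_i ≅ B_{p(i)}.
infix 4 _∼_
_∼_ : List Ty → List Ty → Set
xs ∼ ys = Σ (Permutation (length xs) (length ys))
            (λ p → (i : Fin (length xs)) → lookup xs i ≅ lookup ys (p ⟨$⟩ʳ i))

PFTy : Ty → List Ty
PFTy A = map factorTy (PF A)

-- Let conjuncts A be the list obtained by pushing ⇒ and ∀ through ∧ without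
-- currying.  Iterating the ∀/⇒ axiom and currying turn each prime factor ∀X⃗.((A ∧ Bᵢ) ⇒ Y) of A ⇒ B
-- into A ⇒ ∀X⃗.(Bᵢ ⇒ Y), so PF A and conjuncts A agree elementwise up to ≅.
-- On conjuncts every axiom of ≅ becomes a list law: comm and asso are
-- commutativity and associativity of ++, dist and gen are map-++, and curry
-- and the ∀/⇒ axiom hold elementwise.  Hence conjuncts, and with it PF,
-- respects ≅ up to permutation.
module Submission where

open import Defs
open import Data.Nat using (zero; suc)
open import Data.Maybe using (just; nothing)
open import Data.List using (List; []; _∷_; _++_; map)
open import Data.List.Properties using (map-++; map-∘)
import Data.List.Relation.Binary.Pointwise as Pointwise
open import Data.Product using (_,_)
open import Relation.Binary.PropositionalEquality using (_≡_; refl; cong)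
open import Relation.Binary.Bundles using (Setoid)

≅-setoid : Setoid _ _
≅-setoid = record
  { Carrier = Ty ; _≈_ = _≅_
  ; isEquivalence = record { refl = ≅-refl ; sym = ≅-sym ; trans = ≅-trans } }

open import Data.List.Relation.Binary.Equality.Setoid ≅-setoid
  using (_≋_; ≋-refl; ≋-sym; ≋-trans; ≋-reflexive)
  renaming (map⁺ to map⁺-≋; ++⁺ to ++⁺-≋)
open import Data.List.Relation.Binary.Permutation.Setoid ≅-setoid
open import Data.List.Relation.Binary.Permutation.Setoid.Properties ≅-setoid

map-≋ : {f g : Ty → Ty} → (∀ X → f X ≅ g X) → ∀ xs → map f xs ≋ map g xs
map-≋ {f} {g} f≅g xs = Pointwise.map⁺ f g (Pointwise.refl (λ {X} → f≅g X))

wk-wkN : ∀ k A → wk (wkN k A) ≡ wkN k (wk A)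
wk-wkN zero    A = refl
wk-wkN (suc k) A = cong wk (wk-wkN k A)

cong-∀N : ∀ k {A B} → A ≅ B → ∀N k A ≅ ∀N k B
cong-∀N zero    A≅B = A≅B
cong-∀N (suc k) A≅B = cong-∀ (cong-∀N k A≅B)

∀N-wkN-⇒ : ∀ k A B → ∀N k (wkN k A ⇒ B) ≅ (A ⇒ ∀N k B)
∀N-wkN-⇒ zero    A B = ≅-refl
∀N-wkN-⇒ (suc k) A B rewrite wk-wkN k A = ≅-trans (cong-∀ (∀N-wkN-⇒ k (wk A) B)) p-dist

map-factorTy-≋ : {s : Factor → Factor} (g : Ty → Ty) →
                 (∀ φ → factorTy (s φ) ≅ g (factorTy φ)) →
                 ∀ φs → map factorTy (map s φs) ≋ map g (map factorTy φs)
map-factorTy-≋ g s≅g []       = ≋-refl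
map-factorTy-≋ g s≅g (φ ∷ φs) = s≅g φ Pointwise.∷ map-factorTy-≋ g s≅g φs

PFTy-⇒ : ∀ A B → PFTy (A ⇒ B) ≋ map (A ⇒_) (PFTy B)
PFTy-⇒ A B = map-factorTy-≋ (A ⇒_) (λ
  { (factor k nothing  y) → ∀N-wkN-⇒ k A (var y)
  ; (factor k (just C) y) → ≅-trans (cong-∀N k curry) (∀N-wkN-⇒ k A (C ⇒ var y)) })
  (PF B)

PFTy-∧ : ∀ A B → PFTy (A ∧ B) ≡ PFTy A ++ PFTy B
PFTy-∧ A B = map-++ factorTy (PF A) (PF B)

PFTy-∀ : ∀ A → PFTy (∀' A) ≋ map ∀' (PFTy A)
PFTy-∀ A = map-factorTy-≋ ∀'
  (λ { (factor k nothing y) → ≅-refl ; (factor k (just C) y) → ≅-refl })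
  (PF A)

conjuncts : Ty → List Ty
conjuncts (var x) = var x ∷ []
conjuncts (A ⇒ B) = map (A ⇒_) (conjuncts B)
conjuncts (A ∧ B) = conjuncts A ++ conjuncts B
conjuncts (∀' A)  = map ∀' (conjuncts A)

PFTy≋conjuncts : ∀ A → PFTy A ≋ conjuncts A
PFTy≋conjuncts (var x) = ≋-refl
PFTy≋conjuncts (A ⇒ B) =
  ≋-trans (PFTy-⇒ A B) (map⁺-≋ ≅-setoid (cong-⇒ ≅-refl) (PFTy≋conjuncts B))
PFTy≋conjuncts (A ∧ B) =
  ≋-trans (≋-reflexive (PFTy-∧ A B)) (++⁺-≋ (PFTy≋conjuncts A) (PFTy≋conjuncts B))
PFTy≋conjuncts (∀' A) =
  ≋-trans (PFTy-∀ A) (map⁺-≋ ≅-setoid cong-∀ (PFTy≋conjuncts A))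

conjuncts-resp-≅ : ∀ {A B} → A ≅ B → conjuncts A ↭ conjuncts B
conjuncts-resp-≅ ≅-refl                = ↭-refl
conjuncts-resp-≅ (≅-sym B≅A)           = ↭-sym (conjuncts-resp-≅ B≅A)
conjuncts-resp-≅ (≅-trans A≅B B≅C)     = ↭-trans (conjuncts-resp-≅ A≅B) (conjuncts-resp-≅ B≅C)
conjuncts-resp-≅ (cong-⇒ {B = B} A≅A' B≅B') =
  ↭-transˡ-≋ (map-≋ (λ _ → cong-⇒ A≅A' ≅-refl) (conjuncts B))
             (map⁺ ≅-setoid (cong-⇒ ≅-refl) (conjuncts-resp-≅ B≅B'))
conjuncts-resp-≅ (cong-∧ A≅A' B≅B')    = ++⁺ (conjuncts-resp-≅ A≅A') (conjuncts-resp-≅ B≅B')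
conjuncts-resp-≅ (cong-∀ A≅A')         = map⁺ ≅-setoid cong-∀ (conjuncts-resp-≅ A≅A')
conjuncts-resp-≅ (comm {A} {B})        = ++-comm (conjuncts A) (conjuncts B)
conjuncts-resp-≅ (asso {A} {B} {C})    = ↭-sym (++-assoc (conjuncts A) (conjuncts B) (conjuncts C))
conjuncts-resp-≅ (dist {A} {B} {C})    = ↭-reflexive (map-++ (A ⇒_) (conjuncts B) (conjuncts C))
conjuncts-resp-≅ (gen {A} {B})         = ↭-reflexive (map-++ ∀' (conjuncts A) (conjuncts B))
conjuncts-resp-≅ (curry {A} {B} {C})   = begin
  map ((A ∧ B) ⇒_) (conjuncts C)          ≋⟨ map-≋ (λ _ → curry) (conjuncts C) ⟩
  map (λ X → A ⇒ B ⇒ X) (conjuncts C)     ≡⟨ map-∘ (conjuncts C) ⟩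
  map (A ⇒_) (map (B ⇒_) (conjuncts C))   ∎
  where open PermutationReasoning
conjuncts-resp-≅ (p-dist {A} {B})      = begin
  map ∀' (map (wk A ⇒_) (conjuncts B))    ≡⟨ map-∘ (conjuncts B) ⟨
  map (λ X → ∀' (wk A ⇒ X)) (conjuncts B) ≋⟨ map-≋ (λ _ → p-dist) (conjuncts B) ⟩
  map (λ X → A ⇒ ∀' X) (conjuncts B)      ≡⟨ map-∘ (conjuncts B) ⟩
  map (A ⇒_) (map ∀' (conjuncts B))       ∎
  where open PermutationReasoning

PFTy-resp-≅ : ∀ {A B} → A ≅ B → PFTy A ↭ PFTy B
PFTy-resp-≅ {A} {B} A≅B =
  ↭-transˡ-≋ (PFTy≋conjuncts A) (↭-transʳ-≋ (conjuncts-resp-≅ A≅B) (≋-sym (PFTy≋conjuncts B)))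

mainTheorem5 : (A B : Ty) → A ≅ B → PFTy A ∼ PFTy B
mainTheorem5 A B A≅B = onIndices PFA↭PFB , onIndices-lookup PFA↭PFB
  where PFA↭PFB = PFTy-resp-≅ A≅B
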